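{- Let $\delta\in\mathbb{N}$ and $\rho\in\mathbb{N}\cup\{0\}$. Let $G$ be a graph and let $(T,u)$ be a $(\delta 2^{\rho^2},\rho)$-regular rooted tree where $T$ is a (not necessarily induced) subgraph of $G$. Then there is a $(\delta,\rho)$-regular rooted subtree $(T',u)$ of $(T,u)$ that is path-uniform in $G$.
   Context: Graphs are finite and simple; $\mathbb{N}$ is the positive integers. A rooted tree is a pair $(T,u)$ with $T$ a tree and $u\in V(T)$. For $v\in V(T)$ and $0\le i\le \mathrm{dist}_T(u,v)$, the $i$-ancestor of $v$ in $(T,u)$ is the vertex $v'$ on the $u$–$v$ path in $T$ with $\mathrm{dist}_T(v',v)=i$; a child of $v$ is a vertex whose 1-ancestor is $v$. $N^\rho_T(u)$ is the set of vertices at distance exactly $\rho$ from $u$ in $T$. A rooted subtree of $(T,u)$ is a rooted tree $(T',u')$ with $T'$ an induced subgraph of $T$ such that for every $v\in V(T')$, every child of $v$ in $(T',u')$ is a child of $v$ in $(T,u)$. $(T,u)$ is $(\delta,\rho)$-regular if every vertex is at distance at most $\rho$ from $u$ and every vertex not in $N^\rho_T(u)$ has exactly $\delta$ children. If $T$ is a subgraph of $G$ and $(T,u)$ is $(\delta,\rho)$-regular, then $(T,u)$ is path-uniform in $G$ if for all $v,v'\in N^\rho_T(u)$ and $i,j\in\{0,\dots,\rho\}$, the $i$-ancestor and $j$-ancestor of $v$ are adjacent in $G$ if and only if the $i$-ancestor and $j$-ancestor of $v'$ are adjacent in $G$. -}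

module Defs where

open import Data.Nat using (ℕ; zero; suc; _≤_; _<_)
open import Data.Fin using (Fin; _≟_)
open import Data.Fin.Base using (toℕ)
open import Data.Bool using (Bool; true; false; _∧_; not)
open import Data.List using (List; length; filterᵇ; allFin)
open import Data.Product using (_×_; Σ)
open import Data.Sum using (_⊎_)
open import Function using (_⇔_)
open import Relation.Nullary using (¬_)
open import Relation.Nullary.Decidable using (⌊_⌋)
open import Relation.Binary.PropositionalEquality using (_≡_; _≢_)

record Graph (n : ℕ) : Set where
  field
    adj   : Fin n → Fin n → Bool
    sym   : ∀ a b → adj a b ≡ adj b a
    irref : ∀ a → adj a a ≡ false

Adj : ∀ {n} → Graph n → Fin n → Fin n → Set
Adj G a b = Graph.adj G a b ≡ true

-- A rooted tree (T , root) whose vertex set is a subset of Fin n.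
-- It is encoded by its parent map and depth function: the edges of T are
-- exactly the pairs {v , parent v} for v ∈ V(T), v ≠ root.  The axioms
-- below say precisely that this is a tree rooted at `root`, with `depth v`
-- equal to dist_T(root , v).  (Values of parent/depth outside V(T) are
-- irrelevant.)
record RootedTree (n : ℕ) : Set where
  field
    inT       : Fin n → Bool
    root      : Fin n
    parent    : Fin n → Fin n
    depth     : Fin n → ℕ
    root-in   : inT root ≡ true
    depth-root : depth root ≡ 0
    parent-in : ∀ v → inT v ≡ true → v ≢ root → inT (parent v) ≡ true
    depth-parent : ∀ v → inT v ≡ true → v ≢ root → depth v ≡ suc (depth (parent v))

module _ {n : ℕ} (T : RootedTree n) where
  open RootedTree T

  InT : Fin n → Set
  InT v = inT v ≡ true

  TEdge : Fin n → Fin n → Set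
  TEdge a b = InT a × InT b ×
              ((a ≢ root × parent a ≡ b) ⊎ (b ≢ root × parent b ≡ a))

  isChild : Fin n → Fin n → Bool
  isChild w v = inT w ∧ (not ⌊ w ≟ root ⌋ ∧ ⌊ parent w ≟ v ⌋)

  Child : Fin n → Fin n → Set
  Child w v = isChild w v ≡ true

  numChildren : Fin n → ℕ
  numChildren v = length (filterᵇ (λ w → isChild w v) (allFin n))

  -- i-ancestor of v (meaningful for i ≤ depth v)
  ancestor : Fin n → ℕ → Fin n
  ancestor v zero    = v
  ancestor v (suc i) = parent (ancestor v i)

  AtDepth : ℕ → Fin n → Set
  AtDepth ρ v = InT v × depth v ≡ ρ

SubgraphOf : ∀ {n} → RootedTree n → Graph n → Set
SubgraphOf T G = ∀ a b → TEdge T a b → Adj G a b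

Regular : ∀ {n} → ℕ → ℕ → RootedTree n → Set
Regular δ ρ T = ∀ v → InT T v →
  RootedTree.depth T v ≤ ρ × (¬ AtDepth T ρ v → numChildren T v ≡ δ)

RootedSubtree : ∀ {n} → RootedTree n → RootedTree n → Set
RootedSubtree T' T =
  (∀ v → InT T' v → InT T v) ×
  (∀ a b → InT T' a → InT T' b → (TEdge T' a b ⇔ TEdge T a b)) ×
  (∀ v w → InT T' v → Child T' w v → Child T w v)

PathUniform : ∀ {n} → Graph n → ℕ → RootedTree n → Set
PathUniform G ρ T = ∀ v v' (i j : ℕ) → AtDepth T ρ v → AtDepth T ρ v' →
  i ≤ ρ → j ≤ ρ →
  (Adj G (ancestor T v i) (ancestor T v j) ⇔ Adj G (ancestor T v' i) (ancestor T v' j))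

{-# OPTIONS --safe #-}
module Submission where

-- Record the adjacency among the ρ + 1 vertices of a leaf-to-root path as one of 2^(ρ·ρ)
-- patterns. Call v k-rich for a pattern σ if at least δ of its children are (k − 1)-rich
-- for σ, a vertex at depth ρ being 0-rich for its own pattern. Each of the δ·2^(ρ·ρ)
-- children of a vertex at depth ρ − k is (k − 1)-rich for some pattern, so by pigeonhole
-- δ of them share one pattern σ and the vertex is k-rich for σ. Hence the root is ρ-rich
-- for some σ, and keeping at every vertex δ children that are rich for σ yields a
-- (δ, ρ)-regular subtree all of whose leaves have pattern σ: it is path-uniform.

open import Defs
open import Data.Nat using (ℕ; zero; suc; _+_; _*_; _^_; _∸_; _⊓_; _≤_; _<_; _<?_)
open import Data.Nat.Properties
  using ( +-suc; *-suc; +-∸-assoc; n∸n≡0; m≤n⇒m⊓n≡m; m<n+m; m^n>0; m+1+n≢m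
        ; <-≤-trans; ≮⇒≥; ≤∧≢⇒<; +-monoˡ-≤; +-cancelˡ-<; <-cmp; module ≤-Reasoning)
open import Data.Bool using (Bool; true; false; _∧_)
open import Data.Bool.Properties using (T-≡; T-∧)
open import Data.Fin using (Fin; zero; suc; toℕ; fromℕ<; combine; remQuot; funToFin; finToFun; _≟_)
open import Data.Fin.Properties using (toℕ-fromℕ<; remQuot-combine; finToFun-funToFin; 2↔Bool)
open import Data.List using (List; []; _∷_; length; filter; filterᵇ; take; allFin)
open import Data.List.Properties using (filter-accept; filter-reject; length-take)
open import Data.List.Membership.Propositional using (_∈_; _∉_)
open import Data.List.Membership.Propositional.Properties using (∈-filter⁻)
open import Data.List.Relation.Unary.Any using (here; there)
import Data.List.Relation.Unary.All as All
open import Data.List.Relation.Unary.AllPairs using ([]; _∷_)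
open import Data.List.Relation.Unary.Unique.Propositional using (Unique)
open import Data.List.Relation.Unary.Unique.Propositional.Properties using (allFin⁺)
open import Data.List.Relation.Binary.Sublist.Propositional using (_⊆_; []; _∷_; _∷ʳ_; ⊆-trans)
import Data.List.Relation.Binary.Sublist.Propositional as Sublist
open import Data.List.Relation.Binary.Sublist.Propositional.Properties
  using (filter-⊆; take-⊆; filter⁺; length-mono-≤)
open import Data.Product using (Σ; ∃; _×_; _,_; proj₁; proj₂; map; map₁; uncurry)
open import Data.Product.Function.NonDependent.Propositional using (_×-⇔_)
open import Function using (_∘_)
open import Function.Bundles using (_⇔_; mk⇔; Inverse)
open Function.Bundles.Equivalence using (to; from)
open import Function.Properties.Equivalence using () renaming (trans to ⇔-trans)
open import Function.Construct.Symmetry using (⇔-sym)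
open import Relation.Nullary using (¬_; Dec; yes; no; does; contradiction)
open import Relation.Nullary.Decidable
  using (⌊_⌋; True; False; T?; toWitness; fromWitness; toWitnessFalse; fromWitnessFalse)
open import Relation.Unary using (Pred; Decidable)
open import Relation.Unary.Properties using (∁?)
open import Relation.Binary.PropositionalEquality
open import Relation.Binary.Definitions using (tri<; tri≈; tri>)

module _ {a} {A : Set a} (a? : Dec A) where

  True⇔ : True a? ⇔ A
  True⇔ = mk⇔ toWitness fromWitness

  False⇔¬ : False a? ⇔ (¬ A)
  False⇔¬ = mk⇔ toWitnessFalse fromWitnessFalse

module _ {a p} {A : Set a} {P : Pred A p} (P? : Decidable P) where

  length-filter+length-filter-∁ : ∀ xs →
    length (filter P? xs) + length (filter (∁? P?) xs) ≡ length xs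
  length-filter+length-filter-∁ []       = refl
  length-filter+length-filter-∁ (x ∷ xs) with does (P? x)
  ... | true  = cong suc (length-filter+length-filter-∁ xs)
  ... | false = trans (+-suc _ _) (cong suc (length-filter+length-filter-∁ xs))

  length-filter-filter : ∀ {q} {Q : Pred A q} (Q? : Decidable Q) xs →
    length (filter P? (filter Q? xs)) ≤ length (filter P? xs)
  length-filter-filter Q? xs = length-mono-≤ (filter⁺ P? P? (λ { refl px → px }) (filter-⊆ Q? xs))

  filter-≡-⊆ : ∀ {xs ys} → Unique xs → ys ⊆ xs → (∀ {z} → z ∈ xs → P z ⇔ z ∈ ys) →
               filter P? xs ≡ ys
  filter-≡-⊆ [] [] _ = refl
  filter-≡-⊆ (x∉xs ∷ uniq) (x ∷ʳ ys⊆xs) P⇔∈ = trans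
    (filter-reject P? (x∉ys ∘ to (P⇔∈ (here refl))))
    (filter-≡-⊆ uniq ys⊆xs (P⇔∈ ∘ there))
    where
    x∉ys : x ∉ _
    x∉ys x∈ys = All.lookup x∉xs (Sublist.lookup ys⊆xs x∈ys) refl
  filter-≡-⊆ (x∉xs ∷ uniq) (refl ∷ ys⊆xs) P⇔∈ = trans
    (filter-accept P? (from (P⇔∈ (here refl)) (here refl)))
    (cong (_ ∷_) (filter-≡-⊆ uniq ys⊆xs P⇔∈′))
    where
    P⇔∈′ : ∀ {z} → z ∈ _ → P z ⇔ z ∈ _
    P⇔∈′ z∈xs = mk⇔ (drop-head ∘ to (P⇔∈ (there z∈xs)))
                    (from (P⇔∈ (there z∈xs)) ∘ there)
      where
      drop-head : _ ∈ _ ∷ _ → _ ∈ _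
      drop-head (here z≡x)   = contradiction (sym z≡x) (All.lookup x∉xs z∈xs)
      drop-head (there z∈ys) = z∈ys

pigeonhole-filter : ∀ {a r} {A : Set a} {k} {R : A → Fin k → Set r}
  (R? : ∀ x i → Dec (R x i)) (d : ℕ) (xs : List A) →
  (∀ {x} → x ∈ xs → ∃ (R x)) → d * k < length xs →
  ∃ λ i → d < length (filter (λ x → R? x i) xs)
pigeonhole-filter {k = zero} R? d (x ∷ xs) total _ with () ← total (here refl)
pigeonhole-filter {k = suc k} {R} R? d xs total bound
  with d <? length (filter (λ x → R? x zero) xs)
... | yes many = zero , many
... | no few   = map suc
  (λ {j} many → <-≤-trans many (length-filter-filter (λ x → R? x (suc j)) ¬R₀? xs))
  (pigeonhole-filter (λ x j → R? x (suc j)) d rest total-rest bound-rest)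
  where
  R₀? = λ x → R? x zero
  ¬R₀? = ∁? R₀?
  rest = filter ¬R₀? xs
  total-rest : ∀ {x} → x ∈ rest → ∃ λ j → R x (suc j)
  total-rest x∈ with x∈xs , ¬r₀ ← ∈-filter⁻ ¬R₀? x∈ | total x∈xs
  ... | zero  , r₀ = contradiction r₀ ¬r₀
  ... | suc j , r  = j , r
  bound-rest : d * k < length rest
  bound-rest = +-cancelˡ-< d (d * k) (length rest) (begin-strict
    d + d * k                                    ≡⟨ *-suc d k ⟨
    d * suc k                                    <⟨ bound ⟩
    length xs                                    ≡⟨ length-filter+length-filter-∁ R₀? xs ⟨
    length (filter R₀? xs) + length rest         ≤⟨ +-monoˡ-≤ _ (≮⇒≥ few) ⟩
    d + length rest                              ∎)
    where open ≤-Reasoning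

module _ {n} (T : RootedTree n) where
  open RootedTree T

  child⇔ : ∀ {w v} → Child T w v ⇔ (InT T w × w ≢ root × parent w ≡ v)
  child⇔ {w} {v} = ⇔-trans (⇔-sym T-≡) (⇔-trans T-∧ (T-≡ ×-⇔
    ⇔-trans T-∧ (False⇔¬ (w ≟ root) ×-⇔ True⇔ (parent w ≟ v))))

module Prune {n} (T : RootedTree n)
             (Keep : Fin n → Fin n → Set) (keep? : ∀ v w → Dec (Keep v w))
             (keep⇒child : ∀ {v w} → Keep v w → Child T w v) where
  open RootedTree T

  kept : ℕ → Fin n → Bool
  kept zero    x = ⌊ x ≟ root ⌋
  kept (suc m) x = ⌊ keep? (parent x) x ⌋ ∧ kept m (parent x)

  kept-suc⇔ : ∀ m x → kept (suc m) x ≡ true ⇔ (Keep (parent x) x × kept m (parent x) ≡ true)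
  kept-suc⇔ m x = ⇔-trans (⇔-sym T-≡) (⇔-trans T-∧ (True⇔ (keep? (parent x) x) ×-⇔ T-≡))

  kept⇒InT : ∀ m x → kept m x ≡ true → InT T x
  kept⇒InT zero    x k with refl ← toWitness (from T-≡ k) = root-in
  kept⇒InT (suc m) x k = proj₁ (to (child⇔ T) (keep⇒child (proj₁ (to (kept-suc⇔ m x) k))))

  kept-depth⇔ : ∀ {x} → InT T x → x ≢ root →
    kept (depth x) x ≡ true ⇔ (Keep (parent x) x × kept (depth (parent x)) (parent x) ≡ true)
  kept-depth⇔ {x} x∈T x≢root rewrite depth-parent x x∈T x≢root = kept-suc⇔ (depth (parent x)) x

  kept-root : kept (depth root) root ≡ true
  kept-root rewrite depth-root = to T-≡ (fromWitness refl)

  pruned : RootedTree n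
  pruned = record
    { inT          = λ x → kept (depth x) x
    ; root         = root
    ; parent       = parent
    ; depth        = depth
    ; root-in      = kept-root
    ; depth-root   = depth-root
    ; parent-in    = λ x x∈ x≢root →
                       proj₂ (to (kept-depth⇔ (kept⇒InT (depth x) x x∈) x≢root) x∈)
    ; depth-parent = λ x x∈ → depth-parent x (kept⇒InT (depth x) x x∈)
    }

  pruned⊆T : ∀ {x} → InT pruned x → InT T x
  pruned⊆T {x} = kept⇒InT (depth x) x

  pruned-keeps : ∀ {x} → InT pruned x → x ≢ root → Keep (parent x) x
  pruned-keeps x∈ x≢root = proj₁ (to (kept-depth⇔ (pruned⊆T x∈) x≢root) x∈)

  child-pruned⇔ : ∀ {v w} → InT pruned v → Child pruned w v ⇔ Keep v w
  child-pruned⇔ {v} {w} v∈ = mk⇔ keeps child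
    where
    keeps : Child pruned w v → Keep v w
    keeps c with w∈ , w≢root , refl ← to (child⇔ pruned) c = pruned-keeps w∈ w≢root
    child : Keep v w → Child pruned w v
    child k with w∈T , w≢root , refl ← to (child⇔ T) (keep⇒child k) =
      from (child⇔ pruned) (from (kept-depth⇔ w∈T w≢root) (k , v∈) , w≢root , refl)

  pruned-subtree : RootedSubtree pruned T
  pruned-subtree =
    (λ _ → pruned⊆T) ,
    (λ a b a∈ b∈ → mk⇔ (map pruned⊆T (map₁ pruned⊆T)) (λ (_ , _ , e) → a∈ , b∈ , e)) ,
    (λ v w _ → from (child⇔ T) ∘ map₁ pruned⊆T ∘ to (child⇔ pruned))

  ancestor-pruned : ∀ v i → ancestor pruned v i ≡ ancestor T v i
  ancestor-pruned v zero    = refl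
  ancestor-pruned v (suc i) = cong parent (ancestor-pruned v i)

module Patterns {n} (G : Graph n) (ρ : ℕ) where
  open Graph G using (adj; irref)
  open Inverse 2↔Bool using (strictlyInverseˡ) renaming (to to toBool; from to toFin)

  AdjPattern : Set
  AdjPattern = Fin (2 ^ (ρ * ρ))

  adjBit : (ℕ → Fin n) → Fin ρ → Fin ρ → Fin 2
  adjBit f a b = toFin (adj (f (toℕ a)) (f (suc (toℕ b))))

  -- The ρ × ρ table of bits adj (f a) (f (1 + b)), read as a number below 2 ^ (ρ * ρ).
  -- It records the adjacency of f i and f j for all i < j ≤ ρ.
  adjPattern : (ℕ → Fin n) → AdjPattern
  adjPattern f = funToFin (uncurry (adjBit f) ∘ remQuot {ρ} ρ)

  entry : AdjPattern → Fin ρ → Fin ρ → Bool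
  entry σ a b = toBool (finToFun σ (combine a b))

  entry-adjPattern : ∀ f a b → entry (adjPattern f) a b ≡ adj (f (toℕ a)) (f (suc (toℕ b)))
  entry-adjPattern f a b = begin
    toBool (finToFun (adjPattern f) (combine a b))
      ≡⟨ cong toBool (finToFun-funToFin _ (combine a b)) ⟩
    toBool (uncurry (adjBit f) (remQuot ρ (combine a b)))
      ≡⟨ cong (toBool ∘ uncurry (adjBit f)) (remQuot-combine a b) ⟩
    toBool (adjBit f a b)
      ≡⟨ strictlyInverseˡ _ ⟩
    adj (f (toℕ a)) (f (suc (toℕ b)))
      ∎
    where open ≡-Reasoning

  adjPattern⇒adj< : ∀ {f g i j} → adjPattern f ≡ adjPattern g → i < j → j ≤ ρ →
                    adj (f i) (f j) ≡ adj (g i) (g j)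
  adjPattern⇒adj< {f} {g} {i} {suc j} same i<1+j j<ρ = begin
    adj (f i) (f (suc j))     ≡⟨ read f ⟨
    entry (adjPattern f) a b  ≡⟨ cong (λ σ → entry σ a b) same ⟩
    entry (adjPattern g) a b  ≡⟨ read g ⟩
    adj (g i) (g (suc j))     ∎
    where
    open ≡-Reasoning
    a = fromℕ< (<-≤-trans i<1+j j<ρ)
    b = fromℕ< j<ρ
    read : ∀ h → entry (adjPattern h) a b ≡ adj (h i) (h (suc j))
    read h = subst₂ (λ i′ j′ → entry (adjPattern h) a b ≡ adj (h i′) (h (suc j′)))
                    (toℕ-fromℕ< _) (toℕ-fromℕ< _) (entry-adjPattern h a b)

  adjPattern⇒adj : ∀ {f g i j} → adjPattern f ≡ adjPattern g → i ≤ ρ → j ≤ ρ →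
                   adj (f i) (f j) ≡ adj (g i) (g j)
  adjPattern⇒adj {f} {g} {i} {j} same i≤ρ j≤ρ with <-cmp i j
  ... | tri< i<j _ _  = adjPattern⇒adj< same i<j j≤ρ
  ... | tri≈ _ refl _ = trans (irref (f i)) (sym (irref (g i)))
  ... | tri> _ _ j<i  = trans (Graph.sym G _ _) (trans (adjPattern⇒adj< same j<i i≤ρ) (Graph.sym G _ _))

module Selection {n} (G : Graph n) (T : RootedTree n) (d ρ : ℕ) where
  open RootedTree T
  open Patterns G ρ

  children : Fin n → List (Fin n)
  children v = filterᵇ (λ w → isChild T w v) (allFin n)

  ∈-children⁻ : ∀ {v w} → w ∈ children v → Child T w v
  ∈-children⁻ {v} w∈ =
    to T-≡ (proj₂ (∈-filter⁻ (T? ∘ λ w → isChild T w v) {xs = allFin n} w∈))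

  -- Rich k v σ: v spans a (1 + d)-ary subtree of height k all of whose leaves have pattern σ.
  mutual
    Rich : ℕ → Fin n → AdjPattern → Set
    Rich zero    v σ = adjPattern (ancestor T v) ≡ σ
    Rich (suc k) v σ = d < length (filter (λ w → rich? k w σ) (children v))

    rich? : ∀ k v σ → Dec (Rich k v σ)
    rich? zero    v σ = adjPattern (ancestor T v) ≟ σ
    rich? (suc k) v σ = d <? length (filter (λ w → rich? k w σ) (children v))

  rich-exists : Regular (suc d * 2 ^ (ρ * ρ)) ρ T →
                ∀ k v → InT T v → depth v + k ≡ ρ → ∃ (Rich k v)
  rich-exists reg zero    v _ _ = adjPattern (ancestor T v) , refl
  rich-exists reg (suc k) v v∈T depth+k≡ρ =
    pigeonhole-filter (rich? k) d (children v) child-rich enough-children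
    where
    enough-children : d * 2 ^ (ρ * ρ) < length (children v)
    enough-children = subst (_ <_) (sym (proj₂ (reg v v∈T) not-leaf)) (m<n+m _ (m^n>0 2 (ρ * ρ)))
      where
      not-leaf : ¬ AtDepth T ρ v
      not-leaf (_ , depth≡ρ) = m+1+n≢m (depth v) (trans depth+k≡ρ (sym depth≡ρ))
    child-rich : ∀ {w} → w ∈ children v → ∃ (Rich k w)
    child-rich w∈ with w∈T , w≢root , refl ← to (child⇔ T) (∈-children⁻ w∈) =
      rich-exists reg k _ w∈T (begin
        depth _ + k        ≡⟨ cong (_+ k) (depth-parent _ w∈T w≢root) ⟩
        suc (depth v + k)  ≡⟨ +-suc (depth v) k ⟨
        depth v + suc k    ≡⟨ depth+k≡ρ ⟩
        ρ                  ∎)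
      where open ≡-Reasoning

  module Pick (σ : AdjPattern) (root-rich : Rich ρ root σ) where
    open import Data.List.Membership.DecPropositional (_≟_ {n}) using (_∈?_)

    candidates : Fin n → List (Fin n)
    candidates v = filter (λ w → rich? (ρ ∸ suc (depth v)) w σ) (children v)

    picked : Fin n → List (Fin n)
    picked v = take (suc d) (candidates v)

    picked⊆candidates : ∀ v → picked v ⊆ candidates v
    picked⊆candidates v = take-⊆ (suc d) (candidates v)

    picked⊆allFin : ∀ v → picked v ⊆ allFin n
    picked⊆allFin v = ⊆-trans (picked⊆candidates v) (⊆-trans (filter-⊆ _ _) (filter-⊆ _ _))

    ∈-picked⁻ : ∀ {v w} → w ∈ picked v → w ∈ children v × Rich (ρ ∸ suc (depth v)) w σ
    ∈-picked⁻ {v} w∈ =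
      ∈-filter⁻ (λ w → rich? _ w σ) {xs = children v} (Sublist.lookup (picked⊆candidates v) w∈)

    open Prune T (λ v w → w ∈ picked v) (λ v w → w ∈? picked v) (∈-children⁻ ∘ proj₁ ∘ ∈-picked⁻)
      public

    pruned-rich : ∀ {x} → InT pruned x → Rich (ρ ∸ depth x) x σ
    pruned-rich {x} x∈ with x ≟ root
    ... | yes refl  = subst (λ k → Rich (ρ ∸ k) root σ) (sym depth-root) root-rich
    ... | no x≢root = subst (λ k → Rich (ρ ∸ k) x σ) (sym (depth-parent x (pruned⊆T x∈) x≢root))
                            (proj₂ (∈-picked⁻ (pruned-keeps x∈ x≢root)))

    -- (1 + ρ) ∸ (1 + depth v) computes to ρ ∸ depth v.
    enough-candidates : ∀ {v} → InT pruned v → depth v < ρ → d < length (candidates v)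
    enough-candidates {v} v∈ depth<ρ =
      subst (λ k → Rich k v σ) (+-∸-assoc 1 depth<ρ) (pruned-rich v∈)

    numChildren-pruned : ∀ {v} → InT pruned v → numChildren pruned v ≡ length (picked v)
    numChildren-pruned {v} v∈ = cong length
      (filter-≡-⊆ (T? ∘ λ w → isChild pruned w v) (allFin⁺ n) (picked⊆allFin v)
                  (λ _ → ⇔-trans T-≡ (child-pruned⇔ v∈)))

    pruned-regular : ∀ {δ} → Regular δ ρ T → Regular (suc d) ρ pruned
    pruned-regular reg v v∈ = depth≤ρ , numChildren≡
      where
      depth≤ρ = proj₁ (reg v (pruned⊆T v∈))
      numChildren≡ : ¬ AtDepth pruned ρ v → numChildren pruned v ≡ suc d
      numChildren≡ not-leaf = begin
        numChildren pruned v           ≡⟨ numChildren-pruned v∈ ⟩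
        length (picked v)              ≡⟨ length-take (suc d) (candidates v) ⟩
        suc d ⊓ length (candidates v)  ≡⟨ m≤n⇒m⊓n≡m (enough-candidates v∈ depth<ρ) ⟩
        suc d                          ∎
        where
        open ≡-Reasoning
        depth<ρ = ≤∧≢⇒< depth≤ρ (not-leaf ∘ (v∈ ,_))

    leaf-adjPattern : ∀ {v} → AtDepth pruned ρ v → adjPattern (ancestor T v) ≡ σ
    leaf-adjPattern {v} (v∈ , depth≡ρ) =
      subst (λ k → Rich k v σ) (trans (cong (ρ ∸_) depth≡ρ) (n∸n≡0 ρ)) (pruned-rich v∈)

    pruned-pathUniform : PathUniform G ρ pruned
    pruned-pathUniform v v′ i j v-leaf v′-leaf i≤ρ j≤ρ
      rewrite ancestor-pruned v i | ancestor-pruned v j | ancestor-pruned v′ i | ancestor-pruned v′ j =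
      mk⇔ (trans (sym same)) (trans same)
      where
      same = adjPattern⇒adj (trans (leaf-adjPattern v-leaf) (sym (leaf-adjPattern v′-leaf))) i≤ρ j≤ρ

lemma4p2 : ∀ {n : ℕ} (δ ρ : ℕ) → 1 ≤ δ → (G : Graph n) (T : RootedTree n) →
    SubgraphOf T G → Regular (δ * 2 ^ (ρ * ρ)) ρ T →
    Σ (RootedTree n) λ T' → RootedTree.root T' ≡ RootedTree.root T ×
      RootedSubtree T' T × Regular δ ρ T' × PathUniform G ρ T'
-- Path-uniformity does not need T to be a subgraph of G.
lemma4p2 (suc d) ρ _ G T _ reg = pruned , refl , pruned-subtree , pruned-regular reg , pruned-pathUniform
  where
  open RootedTree T using (root; root-in; depth-root)
  open Selection G T d ρ
  root-rich = rich-exists reg ρ root root-in (cong (_+ ρ) depth-root)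
  open Pick (proj₁ root-rich) (proj₂ root-rich)
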